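{- Let $T$ be a finite set, and let $a_t$ be an integer for every $t\in T$. Then there exists one and only one finite holey subset $S$ of $\mathbb{Z}$ such that \[ \sum_{t\in T} f_{n+a_t} = \sum_{s\in S} f_{n+s} \] for every $n\in\mathbb{Z}$ which satisfies $n>\max\left(\{ -a_t \mid t\in T\}\cup\{ -s\mid s\in S\}\right)$.
   Context: A subset $S$ of $\mathbb{Z}$ is called holey if $s+1\notin S$ for every $s\in S$ (i.e., no two elements of $S$ are consecutive integers). $(f_1,f_2,f_3,\dots)$ denotes the Fibonacci sequence, defined by $f_1=f_2=1$ and $f_n=f_{n-1}+f_{n-2}$ for all integers $n\ge 3$; $f_m$ is only defined for positive integers $m$ (the condition on $n$ ensures all indices appearing are positive). -}

module Defs where

open import Data.Nat using (ℕ; zero; suc; _+_)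
open import Data.Fin using (Fin; zero; suc)
open import Data.Integer as ℤ using (ℤ; +_; -[1+_])
open import Data.List using (List; map)
open import Data.Nat.ListAction using (sum)
open import Data.List.Membership.Propositional using (_∈_; _∉_)
open import Data.List.Relation.Unary.Unique.Propositional using (Unique)
open import Data.Product using (_×_)
open import Relation.Binary.PropositionalEquality using (_≡_)

-- Standard Fibonacci on ℕ: fib 0 = 0, fib 1 = 1, fib (n+2) = fib (n+1) + fib n.
-- Hence fib m = f_m for every m ≥ 1 (f_1 = f_2 = 1).
fib : ℕ → ℕ
fib zero = zero
fib (suc zero) = suc zero
fib (suc (suc n)) = fib (suc n) + fib n

-- f_m for an integer index m.  Only ever evaluated at m ≥ 1 in the theorem
-- (guaranteed by the hypotheses on n); the value at m ≤ 0 is irrelevant junk.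
f : ℤ → ℕ
f (+ m) = fib m
f -[1+ m ] = zero

sumFin : (k : ℕ) → (Fin k → ℕ) → ℕ
sumFin zero g = zero
sumFin (suc k) g = g zero + sumFin k (λ t → g (suc t))

-- A finite subset S of ℤ is represented by a duplicate-free list of its elements.
-- Holey: s + 1 ∉ S for every s ∈ S.
Holey : List ℤ → Set
Holey S = ∀ s → s ∈ S → (s ℤ.+ ℤ.1ℤ) ∉ S

FiniteHoley : List ℤ → Set
FiniteHoley S = Unique S × Holey S

Represents : (k : ℕ) → (Fin k → ℤ) → List ℤ → Set
Represents k a S =
  ∀ (n : ℤ) → (∀ t → ℤ.- a t ℤ.< n) → (∀ s → s ∈ S → ℤ.- s ℤ.< n) →
  sumFin k (λ t → f (n ℤ.+ a t)) ≡ sum (map (λ s → f (n ℤ.+ s)) S)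

module Submission where

-- Existence.  Extend Fibonacci to all of ℤ by the same recurrence (fibℤ) and
-- read a list of integers L as the function  n ↦ Σ_{s ∈ L} fibℤ (n + s).  Two
-- local moves preserve this function:
--   pair rule   :  {x, x + 1}  ↦  {x + 2}          (F_x + F_(x+1) = F_(x+2))
--   double rule :  {x, x}      ↦  {x - 2, x + 1}   (2 F_x = F_(x-2) + F_(x+1))
-- Inserting the shifts a_t one by one into a sparse (increasing, gaps ≥ 2)
-- list, repairing with these moves, yields a sparse list with the same
-- function; sparse lists are holey and duplicate-free, and for n above all
-- indices fibℤ is the ordinary f, which gives the required identity.
--
-- Uniqueness.  Zeckendorf's theorem for holey sets of indices in [2, m]: their
-- sum is below f_(m+1) (so the top index is determined by the sum), and equal
-- sums force equal sets, by induction on m.  Two representations of the same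
-- data, shifted by a large n into [2, m], have equal sums and hence coincide.
--
-- Lists play the role of finite sets;
-- uniqueness is proved up to permutation (_↭_), which gives equal membership.

open import Defs
open import Algebra.Bundles using (AbelianGroup)
open import Data.Empty using (⊥; ⊥-elim)
open import Data.Fin using (Fin; zero; suc)
open import Data.Integer as ℤ using (ℤ; +_; -[1+_]; _+_; _-_; _≤_; _<_; 0ℤ)
import Data.Integer.Properties as ℤP
open import Data.Integer.Tactic.RingSolver using (solve-∀)
open import Data.List using (List; []; _∷_; _++_; foldr; map; tabulate)
open import Data.List.Membership.DecPropositional ℤ._≟_ using (_∈?_)
open import Data.List.Membership.Propositional using (_∈_; _∉_)
open import Data.List.Membership.Propositional.Properties using (∈-∃++; ∈-map⁻)
open import Data.List.Properties using (map-injective; map-∘)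
open import Data.List.Relation.Binary.Permutation.Propositional
  using (_↭_; ↭-sym; ↭-refl; ↭-trans; ↭-prep; ↭⇒↭ₛ)
open import Data.List.Relation.Binary.Permutation.Propositional.Properties
  using (shift; ∈-resp-↭; All-resp-↭; map⁺; ↭-map-inv)
import Data.List.Relation.Binary.Permutation.Setoid.Properties as PermutationSetoid
open import Data.List.Relation.Unary.All as All using (All; []; _∷_)
import Data.List.Relation.Unary.All.Properties as AllP
open import Data.List.Relation.Unary.AllPairs as AllPairs using (AllPairs; []; _∷_)
open import Data.List.Relation.Unary.Any using (here; there)
open import Data.List.Relation.Unary.Unique.Propositional using (Unique)
import Data.List.Relation.Unary.Unique.Propositional.Properties as UniqueP
open import Data.Nat as ℕ using (ℕ; zero; suc)
open import Data.Nat.ListAction using (sum)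
open import Data.Nat.ListAction.Properties using (sum-↭)
import Data.Nat.Properties as ℕP
open import Data.Product using (_×_; _,_; proj₁; proj₂; ∃-syntax)
open import Data.Sum using (_⊎_; inj₁; inj₂)
open import Function using (_∘_)
open import Relation.Binary.PropositionalEquality
open import Relation.Nullary using (yes; no; ¬_)
open import Algebra.Properties.Group (AbelianGroup.group ℤP.+-0-abelianGroup) using (∙-cancelˡ)

+-cancelˡ : ∀ n {u v : ℤ} → n + u ≡ n + v → u ≡ v
+-cancelˡ n = ∙-cancelˡ n _ _

≤+ : ∀ x k → x ≤ x + + k
≤+ x k = ℤP.i≤i+j x (+ k)

-+≤ : ∀ x k → x - + k ≤ x
-+≤ x k = ℤP.i-j≤i x (+ k)

≤-step : ∀ x k → x + + k ≤ x + + suc k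
≤-step x k = ℤP.+-monoʳ-≤ x (ℤ.+≤+ (ℕP.n≤1+n k))

no-descent : ∀ x k → x + + suc k ≤ x → ⊥
no-descent x k = ℤP.<⇒≱ x<x+k
  where
  x<x+k : x < x + + suc k
  x<x+k = subst (_< x + + suc k) (ℤP.+-identityʳ x) (ℤP.+-monoʳ-< x (ℤ.+<+ (ℕ.s≤s ℕ.z≤n)))

gap-two : ∀ {x t} → x ≤ t → t ≢ x → t ≢ x + + 1 → x + + 2 ≤ t
gap-two {x} {t} x≤t t≢x t≢x+1 = subst (_≤ t) (two-steps x) (step (step x≤t (t≢x ∘ sym)) 1+x≢t)
  where
  step : ∀ {i j} → i ≤ j → i ≢ j → ℤ.suc i ≤ j
  step i≤j i≢j = ℤP.i<j⇒suc[i]≤j (ℤP.≤∧≢⇒< i≤j i≢j)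
  1+x≢t : ℤ.suc x ≢ t
  1+x≢t e = t≢x+1 (trans (sym e) (ℤP.+-comm (+ 1) x))
  two-steps : ∀ x → + 1 + (+ 1 + x) ≡ x + + 2
  two-steps = solve-∀

beyond-neighbour : ∀ {a s} → ¬ a ≤ s → a ≢ s + + 1 → s + + 2 ≤ a
beyond-neighbour a≰s a≢s+1 = gap-two (ℤP.<⇒≤ s<a) (ℤP.<⇒≢ s<a ∘ sym) a≢s+1
  where s<a = ℤP.≰⇒> a≰s

add-sub-two : ∀ x → (x + + 2) - + 2 ≡ x
add-sub-two = solve-∀

sub-add-two : ∀ x → (x - + 2) + + 2 ≡ x
sub-add-two = solve-∀

one-then-two : ∀ x → (x + + 1) + + 2 ≡ (x + + 2) + + 1
one-then-two = solve-∀

-- fibNeg m = F_(-(m+1)), continuing the recurrence to the left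
fibNeg : ℕ → ℤ
fibNeg zero = + 1
fibNeg (suc zero) = -[1+ 0 ]
fibNeg (suc (suc m)) = fibNeg m - fibNeg (suc m)

fibℤ : ℤ → ℤ
fibℤ (+ m) = + fib m
fibℤ -[1+ m ] = fibNeg m

fibℤ-rec : ∀ x → fibℤ (x + + 2) ≡ fibℤ (x + + 1) + fibℤ x
fibℤ-rec (+ m) rewrite ℕP.+-comm m 2 | ℕP.+-comm m 1 = refl
fibℤ-rec -[1+ zero ] = refl
fibℤ-rec -[1+ suc zero ] = refl
fibℤ-rec -[1+ suc (suc m) ] = undo-subtraction (fibNeg m) (fibNeg (suc m))
  where
  undo-subtraction : ∀ u v → u ≡ v + (u - v)
  undo-subtraction = solve-∀

fibℤ-agrees : ∀ {i} → 0ℤ ≤ i → fibℤ i ≡ + f i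
fibℤ-agrees {+ _} _ = refl

fibℤ-double : ∀ y → fibℤ (y - + 2) + fibℤ (y + + 1) ≡ fibℤ y + fibℤ y
fibℤ-double y = begin
  fibℤ z + fibℤ (y + + 1)                             ≡⟨ cong (λ i → fibℤ z + fibℤ i) (index y) ⟩
  fibℤ z + fibℤ ((z + + 1) + + 2)                     ≡⟨ cong (λ u → fibℤ z + u) (fibℤ-rec (z + + 1)) ⟩
  fibℤ z + (fibℤ ((z + + 1) + + 1) + fibℤ (z + + 1))  ≡⟨ cong (λ i → fibℤ z + (fibℤ i + fibℤ (z + + 1)))
                                                              (ℤP.+-assoc z (+ 1) (+ 1)) ⟩
  fibℤ z + (fibℤ (z + + 2) + fibℤ (z + + 1))          ≡⟨ rearrange (fibℤ z) (fibℤ (z + + 2)) (fibℤ (z + + 1)) ⟩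
  fibℤ (z + + 2) + (fibℤ (z + + 1) + fibℤ z)          ≡⟨ cong (λ u → fibℤ (z + + 2) + u) (sym (fibℤ-rec z)) ⟩
  fibℤ (z + + 2) + fibℤ (z + + 2)                     ≡⟨ cong (λ i → fibℤ i + fibℤ i) (sub-add-two y) ⟩
  fibℤ y + fibℤ y                                     ∎
  where
  open ≡-Reasoning
  z = y - + 2
  index : ∀ y → y + + 1 ≡ ((y - + 2) + + 1) + + 2
  index = solve-∀
  rearrange : ∀ a b c → a + (b + c) ≡ b + (c + a)
  rearrange = solve-∀

fibSum : ℤ → List ℤ → ℤ
fibSum n [] = 0ℤ
fibSum n (s ∷ L) = fibℤ (n + s) + fibSum n L

fibSum-swap : ∀ n x y L → fibSum n (x ∷ y ∷ L) ≡ fibSum n (y ∷ x ∷ L)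
fibSum-swap n x y L = left-comm (fibℤ (n + x)) (fibℤ (n + y)) (fibSum n L)
  where
  left-comm : ∀ u v w → u + (v + w) ≡ v + (u + w)
  left-comm = solve-∀

pair-rule : ∀ n x L → fibSum n ((x + + 2) ∷ L) ≡ fibSum n (x ∷ (x + + 1) ∷ L)
pair-rule n x L = begin
  fibℤ (n + (x + + 2)) + V                 ≡⟨ cong (λ i → fibℤ i + V) (sym (ℤP.+-assoc n x (+ 2))) ⟩
  fibℤ (y + + 2) + V                       ≡⟨ cong (_+ V) (trans (fibℤ-rec y) (ℤP.+-comm (fibℤ (y + + 1)) (fibℤ y))) ⟩
  (fibℤ y + fibℤ (y + + 1)) + V            ≡⟨ ℤP.+-assoc (fibℤ y) _ V ⟩
  fibℤ y + (fibℤ (y + + 1) + V)            ≡⟨ cong (λ i → fibℤ y + (fibℤ i + V)) (ℤP.+-assoc n x (+ 1)) ⟩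
  fibℤ y + (fibℤ (n + (x + + 1)) + V)      ∎
  where
  open ≡-Reasoning
  V = fibSum n L
  y = n + x

double-rule : ∀ n x L → fibSum n ((x - + 2) ∷ (x + + 1) ∷ L) ≡ fibSum n (x ∷ x ∷ L)
double-rule n x L = begin
  fibℤ (n + (x - + 2)) + (fibℤ (n + (x + + 1)) + V)  ≡⟨ cong₂ (λ i j → fibℤ i + (fibℤ j + V))
                                                               (sym (ℤP.+-assoc n x (ℤ.- + 2)))
                                                               (sym (ℤP.+-assoc n x (+ 1))) ⟩
  fibℤ (y - + 2) + (fibℤ (y + + 1) + V)              ≡⟨ sym (ℤP.+-assoc (fibℤ (y - + 2)) _ V) ⟩
  (fibℤ (y - + 2) + fibℤ (y + + 1)) + V              ≡⟨ cong (_+ V) (fibℤ-double y) ⟩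
  (fibℤ y + fibℤ y) + V                              ≡⟨ ℤP.+-assoc (fibℤ y) _ V ⟩
  fibℤ y + (fibℤ y + V)                              ∎
  where
  open ≡-Reasoning
  V = fibSum n L
  y = n + x

-- push x L adds x to a list L whose elements are all ≥ x: a clash with x
-- or x + 1 at the front is resolved by the double or the pair rule
push : ℤ → List ℤ → List ℤ
push x [] = x ∷ []
push x (t ∷ L) with t ℤ.≟ x
... | yes _ = (x - + 2) ∷ push (x + + 1) L
... | no _ with t ℤ.≟ x + + 1
...   | yes _ = push (x + + 2) L
...   | no _ = x ∷ t ∷ L

insert : ℤ → List ℤ → List ℤ
insert a [] = a ∷ []
insert a (s ∷ L) with a ℤ.≤? s
... | yes _ = push a (s ∷ L)
... | no _ with a ℤ.≟ s + + 1
...   | yes _ = push (s + + 2) L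
...   | no _ = push s (insert a L)

normalize : List ℤ → List ℤ
normalize = foldr insert []

push-fibSum : ∀ n x L → fibSum n (push x L) ≡ fibSum n (x ∷ L)
push-fibSum n x [] = refl
push-fibSum n x (t ∷ L) with t ℤ.≟ x
... | yes refl = begin
  fibSum n ((x - + 2) ∷ push (x + + 1) L)   ≡⟨ cong (λ v → fibℤ (n + (x - + 2)) + v) (push-fibSum n (x + + 1) L) ⟩
  fibSum n ((x - + 2) ∷ (x + + 1) ∷ L)      ≡⟨ double-rule n x L ⟩
  fibSum n (x ∷ x ∷ L)                      ∎
  where open ≡-Reasoning
... | no _ with t ℤ.≟ x + + 1
...   | yes refl = trans (push-fibSum n (x + + 2) L) (pair-rule n x L)
...   | no _ = refl

insert-fibSum : ∀ n a L → fibSum n (insert a L) ≡ fibSum n (a ∷ L)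
insert-fibSum n a [] = refl
insert-fibSum n a (s ∷ L) with a ℤ.≤? s
... | yes _ = push-fibSum n a (s ∷ L)
... | no _ with a ℤ.≟ s + + 1
...   | yes refl = begin
  fibSum n (push (s + + 2) L)          ≡⟨ push-fibSum n (s + + 2) L ⟩
  fibSum n ((s + + 2) ∷ L)             ≡⟨ pair-rule n s L ⟩
  fibSum n (s ∷ (s + + 1) ∷ L)         ≡⟨ fibSum-swap n s (s + + 1) L ⟩
  fibSum n ((s + + 1) ∷ s ∷ L)         ∎
  where open ≡-Reasoning
...   | no _ = begin
  fibSum n (push s (insert a L))       ≡⟨ push-fibSum n s (insert a L) ⟩
  fibSum n (s ∷ insert a L)            ≡⟨ cong (λ v → fibℤ (n + s) + v) (insert-fibSum n a L) ⟩
  fibSum n (s ∷ a ∷ L)                 ≡⟨ fibSum-swap n s a L ⟩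
  fibSum n (a ∷ s ∷ L)                 ∎
  where open ≡-Reasoning

normalize-fibSum : ∀ n T → fibSum n (normalize T) ≡ fibSum n T
normalize-fibSum n [] = refl
normalize-fibSum n (a ∷ T) =
  trans (insert-fibSum n a (normalize T)) (cong (λ v → fibℤ (n + a) + v) (normalize-fibSum n T))

Sparse : List ℤ → Set
Sparse = AllPairs (λ x y → x + + 2 ≤ y)

Above : ℤ → List ℤ → Set
Above c = All (c ≤_)

weaken : ∀ {c d L} → c ≤ d → Above d L → Above c L
weaken c≤d = All.map (ℤP.≤-trans c≤d)

sparse-tail : ∀ {t L} → Sparse (t ∷ L) → Above t L
sparse-tail {t} (t+2≤L ∷ _) = weaken (≤+ t 2) t+2≤L

push-above : ∀ {x L} → Sparse L → Above (x + + 1) L → Above x (push x L)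
push-above {x} {[]} _ _ = ℤP.≤-refl ∷ []
push-above {x} {t ∷ L} (t+2≤L ∷ S) (x+1≤t ∷ x+1≤L) with t ℤ.≟ x
... | yes refl = ⊥-elim (no-descent t 0 x+1≤t)
... | no _ with t ℤ.≟ x + + 1
...   | yes refl = weaken (≤+ x 2) (push-above S (subst (λ c → Above c L) (one-then-two x) t+2≤L))
...   | no _ = ℤP.≤-refl ∷ weaken (≤+ x 1) (x+1≤t ∷ x+1≤L)

push-sparse : ∀ {x L} → Sparse L → Above x L → Sparse (push x L) × Above (x - + 2) (push x L)
push-sparse {x} {[]} _ _ = ([] ∷ []) , (-+≤ x 2 ∷ [])
push-sparse {x} {t ∷ L} (t+2≤L ∷ S) (x≤t ∷ x≤L) with t ℤ.≟ x
... | yes refl =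
  (subst (λ c → Above c (push (x + + 1) L)) (sym (sub-add-two x)) (weaken (≤+ x 1) rest-above)
     ∷ proj₁ (push-sparse S (weaken (≤-step x 1) t+2≤L))) ,
  (ℤP.≤-refl ∷ weaken (ℤP.≤-trans (-+≤ x 2) (≤+ x 1)) rest-above)
  where
  rest-above : Above (x + + 1) (push (x + + 1) L)
  rest-above = push-above S (subst (λ c → Above c L) (sym (ℤP.+-assoc x (+ 1) (+ 1))) t+2≤L)
... | no t≢x with t ℤ.≟ x + + 1
...   | yes refl = proj₁ (push-sparse S (weaken (≤+ (x + + 2) 1) L-above)) ,
                   weaken (ℤP.≤-trans (-+≤ x 2) (≤+ x 2)) (push-above S L-above)
  where
  L-above : Above ((x + + 2) + + 1) L
  L-above = subst (λ c → Above c L) (one-then-two x) t+2≤L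
...   | no t≢x+1 = ((x+2≤t ∷ weaken x+2≤t (sparse-tail (t+2≤L ∷ S))) ∷ t+2≤L ∷ S) ,
                   weaken (-+≤ x 2) (ℤP.≤-refl ∷ x≤t ∷ x≤L)
  where
  x+2≤t : x + + 2 ≤ t
  x+2≤t = gap-two x≤t t≢x t≢x+1

mutual
  insert-sparse : ∀ {a L} → Sparse L → Sparse (insert a L)
  insert-sparse {a} {[]} _ = [] ∷ []
  insert-sparse {a} {s ∷ L} S′@(s+2≤L ∷ S) with a ℤ.≤? s
  ... | yes a≤s = proj₁ (push-sparse S′ (a≤s ∷ weaken a≤s (sparse-tail S′)))
  ... | no a≰s with a ℤ.≟ s + + 1
  ...   | yes refl = proj₁ (push-sparse S s+2≤L)
  ...   | no a≢s+1 = proj₁ (push-sparse (insert-sparse S) (insert-beyond S s+2≤L a≰s a≢s+1))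

  insert-above : ∀ {c a L} → Sparse L → Above c L → c ≤ a → Above (c - + 2) (insert a L)
  insert-above {c} {a} {[]} _ _ c≤a = ℤP.≤-trans (-+≤ c 2) c≤a ∷ []
  insert-above {c} {a} {s ∷ L} S′@(s+2≤L ∷ S) (c≤s ∷ _) c≤a with a ℤ.≤? s
  ... | yes a≤s = weaken (ℤP.+-monoˡ-≤ (ℤ.- + 2) c≤a)
                    (proj₂ (push-sparse S′ (a≤s ∷ weaken a≤s (sparse-tail S′))))
  ... | no a≰s with a ℤ.≟ s + + 1
  ...   | yes refl = weaken (ℤP.≤-trans (-+≤ c 2) (subst (c ≤_) (sym (add-sub-two s)) c≤s))
                       (proj₂ (push-sparse S s+2≤L))
  ...   | no a≢s+1 = weaken (ℤP.+-monoˡ-≤ (ℤ.- + 2) c≤s)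
                       (proj₂ (push-sparse (insert-sparse S) (insert-beyond S s+2≤L a≰s a≢s+1)))

  insert-beyond : ∀ {a s L} → Sparse L → Above (s + + 2) L → ¬ a ≤ s → a ≢ s + + 1 → Above s (insert a L)
  insert-beyond {a} {s} {L} S s+2≤L a≰s a≢s+1 =
    subst (λ c → Above c (insert a L)) (add-sub-two s) (insert-above S s+2≤L (beyond-neighbour a≰s a≢s+1))

normalize-sparse : ∀ T → Sparse (normalize T)
normalize-sparse [] = []
normalize-sparse (a ∷ T) = insert-sparse (normalize-sparse T)

sparse-apart : ∀ {x y L} → Sparse L → x ∈ L → y ∈ L → x ≡ y ⊎ (x + + 2 ≤ y ⊎ y + + 2 ≤ x)
sparse-apart _ (here refl) (here refl) = inj₁ refl
sparse-apart (x+2≤L ∷ _) (here refl) (there y∈L) = inj₂ (inj₁ (All.lookup x+2≤L y∈L))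
sparse-apart (y+2≤L ∷ _) (there x∈L) (here refl) = inj₂ (inj₂ (All.lookup y+2≤L x∈L))
sparse-apart (_ ∷ S) (there x∈L) (there y∈L) = sparse-apart S x∈L y∈L

sparse-holey : ∀ {L} → Sparse L → Holey L
sparse-holey S s s∈L s+1∈L with sparse-apart S s∈L s+1∈L
... | inj₁ s≡s+1 = no-descent s 0 (subst (s + + 1 ≤_) (sym s≡s+1) ℤP.≤-refl)
... | inj₂ (inj₁ s+2≤s+1) = no-descent (s + + 1) 0 (subst (_≤ s + + 1) (sym (ℤP.+-assoc s (+ 1) (+ 1))) s+2≤s+1)
... | inj₂ (inj₂ s+3≤s) = no-descent s 2 (subst (_≤ s) (ℤP.+-assoc s (+ 1) (+ 2)) s+3≤s)

sparse-finiteHoley : ∀ {L} → Sparse L → FiniteHoley L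
sparse-finiteHoley S =
  AllPairs.map (λ {x} x+2≤y x≡y → no-descent x 1 (subst (x + + 2 ≤_) (sym x≡y) x+2≤y)) S , sparse-holey S

-- Zeckendorf's theorem for holey index sets in [2, m].

Zeckendorf : ℕ → List ℤ → Set
Zeckendorf m S = FiniteHoley S × All (λ x → + 2 ≤ x × x ≤ + m) S

unique-↭ : ∀ {xs ys : List ℤ} → xs ↭ ys → Unique xs → Unique ys
unique-↭ p = PermutationSetoid.AllPairs-resp-↭ (setoid ℤ) ≢-sym
               ((λ where refl q → q) , (λ where refl q → q)) (↭⇒↭ₛ p)

extract : ∀ {x : ℤ} {S} → x ∈ S → ∃[ R ] (S ↭ x ∷ R)
extract x∈S with ys , zs , refl ← ∈-∃++ x∈S = ys ++ zs , shift _ ys zs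

holey-⊆ : ∀ {R S} → (∀ {s} → s ∈ R → s ∈ S) → Holey S → Holey R
holey-⊆ R⊆S H s s∈R s+1∈R = H s (R⊆S s∈R) (R⊆S s+1∈R)

sum-extract : ∀ {x S R} → S ↭ x ∷ R → sum (map f S) ≡ f x ℕ.+ sum (map f R)
sum-extract S↭ = sum-↭ (map⁺ f S↭)

zeck-empty : ∀ {m S} → m ℕ.≤ 1 → Zeckendorf m S → S ≡ []
zeck-empty m≤1 (_ , []) = refl
zeck-empty m≤1 (_ , ((2≤x , x≤m) ∷ _)) with ℤP.drop‿+≤+ (ℤP.≤-trans (ℤP.≤-trans 2≤x x≤m) (ℤ.+≤+ m≤1))
... | ℕ.s≤s ()

zeck-lower : ∀ {m S} → Zeckendorf (suc m) S → + suc m ∉ S → Zeckendorf m S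
zeck-lower {m} {S} (FH , bounds) top∉S = FH , All.tabulate lowered
  where
  lowered : ∀ {x} → x ∈ S → + 2 ≤ x × x ≤ + m
  lowered {x} x∈S = proj₁ (All.lookup bounds x∈S) ,
    ℤP.i<j⇒i≤pred[j] (ℤP.≤∧≢⇒< (proj₂ (All.lookup bounds x∈S)) (λ x≡top → top∉S (subst (_∈ S) x≡top x∈S)))

zeck-split : ∀ {m S} → Zeckendorf (suc m) S → + suc m ∈ S → ∃[ R ] (S ↭ + suc m ∷ R × Zeckendorf m R)
zeck-split {m} {S} ((U , H) , bounds) top∈S with extract top∈S
... | R , S↭ with unique-↭ S↭ U | All-resp-↭ S↭ bounds
...   | top∉R ∷ UR | _ ∷ boundsR =
  R , S↭ , zeck-lower ((UR , holey-⊆ (λ s∈R → ∈-resp-↭ (↭-sym S↭) (there s∈R)) H) , boundsR)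
                      (λ top∈R → All.lookup top∉R top∈R refl)

ZeckBound : ℕ → Set
ZeckBound m = ∀ {S} → Zeckendorf m S → sum (map f S) ℕ.< fib (suc m)

-- if m + 2 is present then m + 1 is absent, and f_(m+2) + f_(m+1) = f_(m+3)
zeck-bound-step : ∀ m → ZeckBound m → ZeckBound (suc m) → ZeckBound (suc (suc m))
zeck-bound-step m bound₀ bound₁ {S} Z with + suc (suc m) ∈? S
... | no top∉S = ℕP.<-≤-trans (bound₁ (zeck-lower Z top∉S)) (ℕP.m≤m+n _ _)
... | yes top∈S with zeck-split Z top∈S
...   | R , S↭ , ZR = begin-strict
  sum (map f S)                          ≡⟨ sum-extract S↭ ⟩
  fib (suc (suc m)) ℕ.+ sum (map f R)    <⟨ ℕP.+-monoʳ-< (fib (suc (suc m))) (bound₀ (zeck-lower ZR m+1∉R)) ⟩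
  fib (suc (suc m)) ℕ.+ fib (suc m)      ∎
  where
  open ℕP.≤-Reasoning
  m+1∉R : + suc m ∉ R
  m+1∉R m+1∈R = proj₂ (proj₁ Z) (+ suc m) (∈-resp-↭ (↭-sym S↭) (there m+1∈R))
                  (subst (_∈ S) (cong +_ (ℕP.+-comm 1 (suc m))) top∈S)

zeck-bound : ∀ m → ZeckBound m
zeck-bound zero Z rewrite zeck-empty ℕ.z≤n Z = ℕ.s≤s ℕ.z≤n
zeck-bound (suc zero) Z rewrite zeck-empty ℕP.≤-refl Z = ℕ.s≤s ℕ.z≤n
zeck-bound (suc (suc m)) = zeck-bound-step m (zeck-bound m) (zeck-bound (suc m))

-- a set of level m + 1 contains m + 1 iff its sum reaches f_(m+1); so two
-- sets with equal sums agree on the top index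
zeck-top-agrees : ∀ {m S S′} → Zeckendorf (suc m) S → Zeckendorf (suc m) S′ →
                  sum (map f S) ≡ sum (map f S′) → + suc m ∈ S → + suc m ∉ S′ → ⊥
zeck-top-agrees {m} {S′ = S′} Z Z′ same top∈S top∉S′ with zeck-split Z top∈S
... | R , S↭ , _ = ℕP.<⇒≱ (zeck-bound m (zeck-lower Z′ top∉S′)) top≤S′
  where
  top≤S′ : fib (suc m) ℕ.≤ sum (map f S′)
  top≤S′ = subst (fib (suc m) ℕ.≤_) (trans (sym (sum-extract S↭)) same) (ℕP.m≤m+n _ _)

ZeckUnique : ℕ → Set
ZeckUnique m = ∀ {S S′} → Zeckendorf m S → Zeckendorf m S′ → sum (map f S) ≡ sum (map f S′) → S ↭ S′

zeck-unique-common-top : ∀ m → ZeckUnique m → ∀ {S S′} → Zeckendorf (suc m) S → Zeckendorf (suc m) S′ →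
                         sum (map f S) ≡ sum (map f S′) → + suc m ∈ S → + suc m ∈ S′ → S ↭ S′
zeck-unique-common-top m unique Z Z′ same top∈S top∈S′ with zeck-split Z top∈S | zeck-split Z′ top∈S′
... | R , S↭ , ZR | R′ , S′↭ , ZR′ = ↭-trans S↭ (↭-trans (↭-prep _ (unique ZR ZR′ same-rest)) (↭-sym S′↭))
  where
  same-rest : sum (map f R) ≡ sum (map f R′)
  same-rest = ℕP.+-cancelˡ-≡ (fib (suc m)) _ _ (trans (sym (sum-extract S↭)) (trans same (sum-extract S′↭)))

zeck-unique-step : ∀ m → ZeckUnique m → ZeckUnique (suc m)
zeck-unique-step m unique {S} {S′} Z Z′ same with + suc m ∈? S | + suc m ∈? S′
... | yes top∈S | yes top∈S′ = zeck-unique-common-top m unique Z Z′ same top∈S top∈S′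
... | yes top∈S | no top∉S′ = ⊥-elim (zeck-top-agrees Z Z′ same top∈S top∉S′)
... | no top∉S | yes top∈S′ = ⊥-elim (zeck-top-agrees Z′ Z (sym same) top∈S′ top∉S)
... | no top∉S | no top∉S′ = unique (zeck-lower Z top∉S) (zeck-lower Z′ top∉S′) same

zeck-unique : ∀ m → ZeckUnique m
zeck-unique zero Z Z′ _ rewrite zeck-empty ℕ.z≤n Z | zeck-empty ℕ.z≤n Z′ = ↭-refl
zeck-unique (suc m) = zeck-unique-step m (zeck-unique m)

above-zero : ∀ {n s} → ℤ.- s < n → 0ℤ ≤ n + s
above-zero {n} {s} -s<n = ℤP.<⇒≤ (subst (_< n + s) (ℤP.+-inverseˡ s) (ℤP.+-monoˡ-< s -s<n))

fibSum-natural : ∀ n L → All (λ s → ℤ.- s < n) L → fibSum n L ≡ + sum (map (λ s → f (n + s)) L)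
fibSum-natural n [] [] = refl
fibSum-natural n (s ∷ L) (p ∷ ps) = cong₂ _+_ (fibℤ-agrees (above-zero p)) (fibSum-natural n L ps)

sumFin-tabulate : ∀ k (h : Fin k → ℤ) (F : ℤ → ℕ) → sumFin k (λ t → F (h t)) ≡ sum (map F (tabulate h))
sumFin-tabulate zero h F = refl
sumFin-tabulate (suc k) h F = cong (F (h zero) ℕ.+_) (sumFin-tabulate k (h ∘ suc) F)

normalize-represents : ∀ k (a : Fin k → ℤ) → Represents k a (normalize (tabulate a))
normalize-represents k a n large-a large-N =
  trans (sumFin-tabulate k a (λ s → f (n + s))) (ℤP.+-injective (begin
    + sum (map (λ s → f (n + s)) T)                ≡⟨ sym (fibSum-natural n T (AllP.tabulate⁺ large-a)) ⟩
    fibSum n T                                     ≡⟨ sym (normalize-fibSum n T) ⟩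
    fibSum n (normalize T)                         ≡⟨ fibSum-natural n (normalize T) (All.tabulate (large-N _)) ⟩
    + sum (map (λ s → f (n + s)) (normalize T))    ∎))
  where
  open ≡-Reasoning
  T = tabulate a

Within : ℕ → ℤ → Set
Within B x = ℤ.- + B ≤ x × x ≤ + B

within-abs : ∀ x → Within ℤ.∣ x ∣ x
within-abs (+ k) = ℤP.neg-≤-pos , ℤP.≤-refl
within-abs -[1+ k ] = ℤP.≤-refl , ℤ.-≤+

within-mono : ∀ {A B x} → A ℕ.≤ B → Within A x → Within B x
within-mono A≤B (lo , hi) = ℤP.≤-trans (ℤP.neg-mono-≤ (ℤ.+≤+ A≤B)) lo , ℤP.≤-trans hi (ℤ.+≤+ A≤B)

bounded : (X : List ℤ) → ∃[ B ] All (Within B) X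
bounded [] = 0 , []
bounded (x ∷ X) with bounded X
... | B , inX = ℤ.∣ x ∣ ℕ.+ B ,
  within-mono (ℕP.m≤m+n _ B) (within-abs x) ∷ All.map (within-mono (ℕP.m≤n+m B _)) inX

window : ∀ B {x} → Within B x → + 2 ≤ (+ 2 + + B) + x × (+ 2 + + B) + x ≤ + (2 ℕ.+ B ℕ.+ B)
window B {x} (lo , hi) = subst (_≤ n + x) (cancel (+ B)) (ℤP.+-monoʳ-≤ n lo) , ℤP.+-monoʳ-≤ n hi
  where
  n = + 2 + + B
  cancel : ∀ b → (+ 2 + b) + ℤ.- b ≡ + 2
  cancel = solve-∀

positive-shift : ∀ {n x} → + 2 ≤ n + x → ℤ.- x < n
positive-shift {n} {x} 2≤n+x = subst₂ _<_ (ℤP.+-identityʳ (ℤ.- x)) (cancel n x)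
  (ℤP.+-monoʳ-< (ℤ.- x) (ℤP.<-≤-trans (ℤ.+<+ (ℕ.s≤s ℕ.z≤n)) 2≤n+x))
  where
  cancel : ∀ n x → ℤ.- x + (n + x) ≡ n
  cancel = solve-∀

translate-zeck : ∀ {n m S} → FiniteHoley S → All (λ x → + 2 ≤ n + x × n + x ≤ + m) S →
                 Zeckendorf m (map (λ x → n + x) S)
translate-zeck {n} {m} {S} (U , H) bounds = (UniqueP.map⁺ (+-cancelˡ n) U , holey) , AllP.map⁺ bounds
  where
  holey : Holey (map (λ x → n + x) S)
  holey y y∈ y+1∈ with ∈-map⁻ (λ x → n + x) y∈ | ∈-map⁻ (λ x → n + x) y+1∈
  ... | s , s∈S , refl | s′ , s′∈S , e =
    H s s∈S (subst (_∈ S) (+-cancelˡ n (trans (sym e) (ℤP.+-assoc n s (+ 1)))) s′∈S)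

↭-map-injective : ∀ {F : ℤ → ℤ} → (∀ {u v} → F u ≡ F v → u ≡ v) → ∀ {S S′} → map F S ↭ map F S′ → S ↭ S′
↭-map-injective {F} inj p with ↭-map-inv F p
... | ys , eq , S↭ys = subst (_ ↭_) (sym (map-injective inj eq)) S↭ys

represents-unique : ∀ k (a : Fin k → ℤ) {S S′} → FiniteHoley S → FiniteHoley S′ →
                    Represents k a S → Represents k a S′ → S ↭ S′
represents-unique k a {S} {S′} FH FH′ R R′ =
  ↭-map-injective (+-cancelˡ n) (zeck-unique m (translate-zeck {n} FH (All.map (window B) inS))
                                                (translate-zeck {n} FH′ (All.map (window B) inS′))
                                                same-translated)
  where
  X = tabulate a ++ S ++ S′
  B = proj₁ (bounded X)
  inT = AllP.++⁻ˡ (tabulate a) (proj₂ (bounded X))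
  inS = AllP.++⁻ˡ S (AllP.++⁻ʳ (tabulate a) (proj₂ (bounded X)))
  inS′ = AllP.++⁻ʳ S (AllP.++⁻ʳ (tabulate a) (proj₂ (bounded X)))
  n = + 2 + + B
  m = 2 ℕ.+ B ℕ.+ B
  large : ∀ {x} → Within B x → ℤ.- x < n
  large w = positive-shift (proj₁ (window B w))
  large-on : ∀ {L} → All (Within B) L → ∀ s → s ∈ L → ℤ.- s < n
  large-on inL s s∈L = large (All.lookup inL s∈L)
  large-a : ∀ t → ℤ.- a t < n
  large-a t = large (AllP.tabulate⁻ inT t)
  same-translated : sum (map f (map (λ x → n + x) S)) ≡ sum (map f (map (λ x → n + x) S′))
  same-translated = begin
    sum (map f (map (λ x → n + x) S))     ≡⟨ cong sum (sym (map-∘ S)) ⟩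
    sum (map (λ s → f (n + s)) S)          ≡⟨ sym (R n large-a (large-on inS)) ⟩
    sumFin k (λ t → f (n + a t))           ≡⟨ R′ n large-a (large-on inS′) ⟩
    sum (map (λ s → f (n + s)) S′)         ≡⟨ cong sum (map-∘ S′) ⟩
    sum (map f (map (λ x → n + x) S′))    ∎
    where open ≡-Reasoning

theorem1 : (k : ℕ) (a : Fin k → ℤ) →
    ∃[ S ] (FiniteHoley S × Represents k a S ×
      (∀ (S′ : List ℤ) → FiniteHoley S′ → Represents k a S′ →
        ∀ (z : ℤ) → (z ∈ S → z ∈ S′) × (z ∈ S′ → z ∈ S)))
theorem1 k a = N , FH , R , λ S′ FH′ R′ z →
  let N↭S′ = represents-unique k a FH FH′ R R′ in ∈-resp-↭ N↭S′ , ∈-resp-↭ (↭-sym N↭S′)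
  where
  N = normalize (tabulate a)
  FH = sparse-finiteHoley (normalize-sparse (tabulate a))
  R = normalize-represents k a
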